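{- Let $F:\mathcal C\to\mathcal S$ be a functor with $\mathcal C$ small, and let $G:\mathcal P\to\mathcal S$ be the projection from the displayed presheaf category. For every presheaf $Z$ on $\mathcal S$ and every locally representable dependent presheaf $B$ over $Z$, the dependent presheaf $G^*B$ over $G^*Z$ on $\mathcal P$ (given by $(G^*B)_c(z)=B_{Gc}(z)$) is locally representable. (Internally to presheaves on $\mathcal P$: for every locally representable $A$ under the modality $G^*$, the presheaf $G^*A$ is locally representable.)
   Context: The displayed presheaf category $\mathcal P$: objects are pairs $(\Gamma,\Gamma^{\dagger})$ with $\Gamma\in\mathcal S$ and $\Gamma^{\dagger}$ a presheaf assigning an $\omega$-small set $\Gamma^{\dagger}(\Theta,\gamma)$ to every $\Theta\in\mathcal C$ and $\gamma\in\mathcal S(F\Theta,\Gamma)$, contravariantly in $(\Theta,\gamma)$; morphisms $(\Gamma,\Gamma^{\dagger})\to(\Delta,\Delta^{\dagger})$ are pairs of $f\in\mathcal S(\Gamma,\Delta)$ and a natural family of maps $\Gamma^{\dagger}(\Theta,\gamma)\to\Delta^{\dagger}(\Theta,f\circ\gamma)$; $G(\Gamma,\Gamma^{\dagger})=\Gamma$. A dependent presheaf $B$ over $Z$ on a category $\mathcal E$ is locally representable if for every $c\in\mathcal E$ and $z\in Z(c)$ the presheaf $(\rho:d\to c)\mapsto B_d(z[\rho])$ on the slice $\mathcal E/c$ is representable. Presheaves here are large ($\mathbf{Set}_{\omega+1}$-valued). -}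

module Defs where

open import Level using (Level; _⊔_; suc; 0ℓ)
open import Data.Product using (Σ; _,_; proj₁; proj₂; _×_)
open import Relation.Binary using (IsEquivalence)
open import Relation.Binary.PropositionalEquality as P
  using (_≡_; refl; subst; cong; cong₂)
open import Relation.Binary.HeterogeneousEquality as H using (_≅_)

-- Categories with hom-setoids (needed because the morphisms of the
-- displayed presheaf category contain functions, and without function
-- extensionality their equality must be the extensional one).

record Category (o h e : Level) : Set (suc (o ⊔ h ⊔ e)) where
  infixr 9 _∘_
  infix 4 _≈_
  field
    Obj : Set o
    Hom : Obj → Obj → Set h
    _≈_ : ∀ {a b} → Hom a b → Hom a b → Set e
    isEquiv : ∀ {a b} → IsEquivalence (_≈_ {a} {b})
    id : ∀ {a} → Hom a a
    _∘_ : ∀ {a b c} → Hom b c → Hom a b → Hom a c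
    assoc : ∀ {a b c d} (f : Hom c d) (g : Hom b c) (k : Hom a b) →
            (f ∘ g) ∘ k ≈ f ∘ (g ∘ k)
    identityˡ : ∀ {a b} (f : Hom a b) → id ∘ f ≈ f
    identityʳ : ∀ {a b} (f : Hom a b) → f ∘ id ≈ f
    ∘-resp-≈ : ∀ {a b c} {f f' : Hom b c} {g g' : Hom a b} →
               f ≈ f' → g ≈ g' → f ∘ g ≈ f' ∘ g'

  ≈-refl : ∀ {a b} {f : Hom a b} → f ≈ f
  ≈-refl = IsEquivalence.refl isEquiv
  ≈-sym : ∀ {a b} {f g : Hom a b} → f ≈ g → g ≈ f
  ≈-sym = IsEquivalence.sym isEquiv
  ≈-trans : ∀ {a b} {f g k : Hom a b} → f ≈ g → g ≈ k → f ≈ k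
  ≈-trans = IsEquivalence.trans isEquiv

record StrictCategory (o h : Level) : Set (suc (o ⊔ h)) where
  infixr 9 _∘_
  field
    Obj : Set o
    Hom : Obj → Obj → Set h
    id : ∀ {a} → Hom a a
    _∘_ : ∀ {a b c} → Hom b c → Hom a b → Hom a c
    assoc : ∀ {a b c d} (f : Hom c d) (g : Hom b c) (k : Hom a b) →
            (f ∘ g) ∘ k ≡ f ∘ (g ∘ k)
    identityˡ : ∀ {a b} (f : Hom a b) → id ∘ f ≡ f
    identityʳ : ∀ {a b} (f : Hom a b) → f ∘ id ≡ f

toCat : ∀ {o h} → StrictCategory o h → Category o h h
toCat S = record
  { Obj = Obj ; Hom = Hom ; _≈_ = _≡_ ; isEquiv = P.isEquivalence
  ; id = id ; _∘_ = _∘_ ; assoc = assoc ; identityˡ = identityˡ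
  ; identityʳ = identityʳ ; ∘-resp-≈ = cong₂ _∘_ }
  where open StrictCategory S

record StrictFunctor {o h o' h'} (C : StrictCategory o h)
       (D : StrictCategory o' h') : Set (o ⊔ h ⊔ o' ⊔ h') where
  private
    module C = StrictCategory C
    module D = StrictCategory D
  field
    F₀ : C.Obj → D.Obj
    F₁ : ∀ {a b} → C.Hom a b → D.Hom (F₀ a) (F₀ b)
    identity : ∀ {a} → F₁ (C.id {a}) ≡ D.id
    homomorphism : ∀ {a b c} (f : C.Hom b c) (g : C.Hom a b) →
                   F₁ (f C.∘ g) ≡ F₁ f D.∘ F₁ g

record Functor {o h e o' h' e'} (C : Category o h e) (D : Category o' h' e')
       : Set (o ⊔ h ⊔ e ⊔ o' ⊔ h' ⊔ e') where
  private
    module C = Category C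
    module D = Category D
  field
    F₀ : C.Obj → D.Obj
    F₁ : ∀ {a b} → C.Hom a b → D.Hom (F₀ a) (F₀ b)
    F-resp-≈ : ∀ {a b} {f g : C.Hom a b} → f C.≈ g → F₁ f D.≈ F₁ g
    identity : ∀ {a} → F₁ (C.id {a}) D.≈ D.id
    homomorphism : ∀ {a b c} (f : C.Hom b c) (g : C.Hom a b) →
                   F₁ (f C.∘ g) D.≈ F₁ f D.∘ F₁ g

record Presheaf {o h e} (E : Category o h e) (p : Level)
       : Set (o ⊔ h ⊔ e ⊔ suc p) where
  open Category E
  field
    F₀ : Obj → Set p
    F₁ : ∀ {a b} → Hom a b → F₀ b → F₀ a
    F-resp : ∀ {a b} {f g : Hom a b} → f ≈ g → ∀ x → F₁ f x ≡ F₁ g x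
    F-id : ∀ {a} (x : F₀ a) → F₁ id x ≡ x
    F-∘ : ∀ {a b c} (f : Hom b c) (g : Hom a b) (x : F₀ c) →
          F₁ (f ∘ g) x ≡ F₁ g (F₁ f x)

record DepPresheaf {o h e p} {E : Category o h e} (Z : Presheaf E p)
       (q : Level) : Set (o ⊔ h ⊔ e ⊔ p ⊔ suc q) where
  open Category E
  private module Z = Presheaf Z
  field
    D₀ : (c : Obj) → Z.F₀ c → Set q
    D₁ : ∀ {a b} (f : Hom a b) {z : Z.F₀ b} → D₀ b z → D₀ a (Z.F₁ f z)
    D-resp : ∀ {a b} {f g : Hom a b} → f ≈ g →
             ∀ {z} (x : D₀ b z) → D₁ f x ≅ D₁ g x
    D-id : ∀ {a} {z} (x : D₀ a z) → D₁ id x ≅ x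
    D-∘ : ∀ {a b c} (f : Hom b c) (g : Hom a b) {z} (x : D₀ c z) →
          D₁ (f ∘ g) x ≅ D₁ g (D₁ f x)

record Representable {o h e p} {E : Category o h e} (X : Presheaf E p)
       : Set (o ⊔ h ⊔ e ⊔ p) where
  open Category E
  private module X = Presheaf X
  field
    r : Obj
    φ : ∀ {a} → Hom a r → X.F₀ a
    ψ : ∀ {a} → X.F₀ a → Hom a r
    φ-resp : ∀ {a} {f g : Hom a r} → f ≈ g → φ f ≡ φ g
    φψ : ∀ {a} (x : X.F₀ a) → φ (ψ x) ≡ x
    ψφ : ∀ {a} (f : Hom a r) → ψ (φ f) ≈ f
    natural : ∀ {a b} (f : Hom b r) (g : Hom a b) → φ (f ∘ g) ≡ X.F₁ g (φ f)

Slice : ∀ {o h e} (E : Category o h e) → Category.Obj E →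
        Category (o ⊔ h) (h ⊔ e) e
Slice E c = record
  { Obj = Σ Obj (λ d → Hom d c)
  ; Hom = λ { (d , ρ) (d' , ρ') → Σ (Hom d d') (λ g → ρ' ∘ g ≈ ρ) }
  ; _≈_ = λ f g → proj₁ f ≈ proj₁ g
  ; isEquiv = record { refl = ≈-refl ; sym = ≈-sym ; trans = ≈-trans }
  ; id = λ { {d , ρ} → id , identityʳ ρ }
  ; _∘_ = λ { {d , ρ} {d' , ρ'} {d'' , ρ''} (g , pg) (k , pk) →
              g ∘ k , ≈-trans (≈-sym (assoc ρ'' g k))
                              (≈-trans (∘-resp-≈ pg ≈-refl) pk) }
  ; assoc = λ f g k → assoc (proj₁ f) (proj₁ g) (proj₁ k)
  ; identityˡ = λ f → identityˡ (proj₁ f)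
  ; identityʳ = λ f → identityʳ (proj₁ f)
  ; ∘-resp-≈ = ∘-resp-≈
  }
  where open Category E

Fiber : ∀ {o h e p q} {E : Category o h e} {Z : Presheaf E p}
        (B : DepPresheaf Z q) (c : Category.Obj E) (z : Presheaf.F₀ Z c) →
        Presheaf (Slice E c) q
Fiber {E = E} {Z} B c z = record
  { F₀ = λ { (d , ρ) → B.D₀ d (Z.F₁ ρ z) }
  ; F₁ = λ { {d , ρ} {d' , ρ'} (g , pg) x → subst (B.D₀ d) (eqZ g pg) (B.D₁ g x) }
  ; F-resp = λ { {d , ρ} {d' , ρ'} {g , pg} {g' , pg'} e x →
      H.≅-to-≡ (H.trans (H.≡-subst-removable (B.D₀ d) (eqZ g pg) (B.D₁ g x))
               (H.trans (B.D-resp e x)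
                 (H.sym (H.≡-subst-removable (B.D₀ d) (eqZ g' pg') (B.D₁ g' x))))) }
  ; F-id = λ { {d , ρ} x →
      H.≅-to-≡ (H.trans (H.≡-subst-removable (B.D₀ d) _ (B.D₁ id x)) (B.D-id x)) }
  ; F-∘ = λ { {d , ρ} {d' , ρ'} {d'' , ρ''} (g , pg) (k , pk) x →
      H.≅-to-≡
        (H.trans (H.≡-subst-removable (B.D₀ d) _ (B.D₁ (g ∘ k) x))
        (H.trans (B.D-∘ g k x)
        (H.trans (D₁-cong k (eqZ g pg)
                   (H.sym (H.≡-subst-removable (B.D₀ d') (eqZ g pg) (B.D₁ g x))))
                 (H.sym (H.≡-subst-removable (B.D₀ d) (eqZ k pk) _))))) }
  }
  where
  open Category E
  module Z = Presheaf Z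
  module B = DepPresheaf B
  eqZ : ∀ {d d'} {ρ : Hom d c} {ρ' : Hom d' c} (g : Hom d d') → ρ' ∘ g ≈ ρ →
        Z.F₁ g (Z.F₁ ρ' z) ≡ Z.F₁ ρ z
  eqZ {ρ = ρ} {ρ'} g pg = P.trans (P.sym (Z.F-∘ ρ' g z)) (Z.F-resp pg z)
  D₁-cong : ∀ {a b} (k : Hom a b) {z₁ z₂ : Z.F₀ b} → z₁ ≡ z₂ →
            {x₁ : B.D₀ b z₁} {x₂ : B.D₀ b z₂} → x₁ ≅ x₂ → B.D₁ k x₁ ≅ B.D₁ k x₂
  D₁-cong k refl H.refl = H.refl

LocallyRepresentable : ∀ {o h e p q} {E : Category o h e} {Z : Presheaf E p}
                       (B : DepPresheaf Z q) → Set (o ⊔ h ⊔ e ⊔ p ⊔ q)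
LocallyRepresentable {E = E} {Z} B =
  (c : Category.Obj E) (z : Presheaf.F₀ Z c) → Representable (Fiber B c z)

reindex : ∀ {o h e o' h' e' p} {E' : Category o' h' e'} {E : Category o h e}
          (G : Functor E' E) → Presheaf E p → Presheaf E' p
reindex G Z = record
  { F₀ = λ c → Z.F₀ (G.F₀ c)
  ; F₁ = λ f → Z.F₁ (G.F₁ f)
  ; F-resp = λ e x → Z.F-resp (G.F-resp-≈ e) x
  ; F-id = λ x → P.trans (Z.F-resp G.identity x) (Z.F-id x)
  ; F-∘ = λ f g x → P.trans (Z.F-resp (G.homomorphism f g) x) (Z.F-∘ _ _ x)
  }
  where module G = Functor G
        module Z = Presheaf Z

reindexDep : ∀ {o h e o' h' e' p q} {E' : Category o' h' e'} {E : Category o h e}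
             (G : Functor E' E) {Z : Presheaf E p} →
             DepPresheaf Z q → DepPresheaf (reindex G Z) q
reindexDep G B = record
  { D₀ = λ c z → B.D₀ (G.F₀ c) z
  ; D₁ = λ f x → B.D₁ (G.F₁ f) x
  ; D-resp = λ e x → B.D-resp (G.F-resp-≈ e) x
  ; D-id = λ x → H.trans (B.D-resp G.identity x) (B.D-id x)
  ; D-∘ = λ f g x → H.trans (B.D-resp (G.homomorphism f g) x) (B.D-∘ _ _ x)
  }
  where module G = Functor G
        module B = DepPresheaf B

module Displayed {o h : Level} (C : StrictCategory 0ℓ 0ℓ)
       (S : StrictCategory o h) (F : StrictFunctor C S) where
  private
    module C = StrictCategory C
    module S = StrictCategory S
    module F = StrictFunctor F
  open S using (_∘_)

  record PObj : Set (suc 0ℓ ⊔ o ⊔ h) where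
    field
      Γ : S.Obj
      Γ† : (Θ : C.Obj) → S.Hom (F.F₀ Θ) Γ → Set
      rest : ∀ {Θ Θ'} (u : C.Hom Θ' Θ) {γ : S.Hom (F.F₀ Θ) Γ} →
             Γ† Θ γ → Γ† Θ' (γ ∘ F.F₁ u)
      rest-id : ∀ {Θ} {γ : S.Hom (F.F₀ Θ) Γ} (x : Γ† Θ γ) → rest C.id x ≅ x
      rest-∘ : ∀ {Θ Θ' Θ''} (u : C.Hom Θ' Θ) (v : C.Hom Θ'' Θ')
               {γ : S.Hom (F.F₀ Θ) Γ} (x : Γ† Θ γ) →
               rest (u C.∘ v) x ≅ rest v (rest u x)

  record PHom (X Y : PObj) : Set (o ⊔ h) where
    private
      module X = PObj X
      module Y = PObj Y
    field
      f : S.Hom X.Γ Y.Γ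
      α : ∀ Θ (γ : S.Hom (F.F₀ Θ) X.Γ) → X.Γ† Θ γ → Y.Γ† Θ (f ∘ γ)
      nat : ∀ {Θ Θ'} (u : C.Hom Θ' Θ) {γ : S.Hom (F.F₀ Θ) X.Γ} (x : X.Γ† Θ γ) →
            α Θ' (γ ∘ F.F₁ u) (X.rest u x) ≅ Y.rest u (α Θ γ x)
  open PHom

  _≈P_ : ∀ {X Y} → PHom X Y → PHom X Y → Set h
  _≈P_ {X} m m' = (f m ≡ f m') ×
    (∀ Θ (γ : S.Hom (F.F₀ Θ) (PObj.Γ X)) x → α m Θ γ x ≅ α m' Θ γ x)

  private
    restcong : ∀ (X : PObj) {Θ Θ'} (u : C.Hom Θ' Θ) {γ₁ γ₂} → γ₁ ≡ γ₂ →
               {x₁ : PObj.Γ† X Θ γ₁} {x₂ : PObj.Γ† X Θ γ₂} → x₁ ≅ x₂ →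
               PObj.rest X u x₁ ≅ PObj.rest X u x₂
    restcong X u refl H.refl = H.refl

    αcong2 : ∀ {X Y} (m m' : PHom X Y) →
             (∀ Θ γ x → α m Θ γ x ≅ α m' Θ γ x) →
             ∀ {Θ γ₁ γ₂} → γ₁ ≡ γ₂ →
             {x₁ : PObj.Γ† X Θ γ₁} {x₂ : PObj.Γ† X Θ γ₂} → x₁ ≅ x₂ →
             α m Θ γ₁ x₁ ≅ α m' Θ γ₂ x₂
    αcong2 m m' hm refl H.refl = hm _ _ _

    αcong : ∀ {X Y} (m : PHom X Y) {Θ γ₁ γ₂} → γ₁ ≡ γ₂ →
            {x₁ : PObj.Γ† X Θ γ₁} {x₂ : PObj.Γ† X Θ γ₂} → x₁ ≅ x₂ →
            α m Θ γ₁ x₁ ≅ α m Θ γ₂ x₂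
    αcong m = αcong2 m m (λ _ _ _ → H.refl)

    sr = H.≡-subst-removable

  idP : ∀ {X} → PHom X X
  idP {X} = record
    { f = S.id
    ; α = λ Θ γ x → subst (X.Γ† Θ) (P.sym (S.identityˡ γ)) x
    ; nat = λ {Θ} {Θ'} u {γ} x →
        H.trans (sr (X.Γ† Θ') _ (X.rest u x))
          (restcong X u (P.sym (S.identityˡ γ)) (H.sym (sr (X.Γ† Θ) _ x)))
    }
    where module X = PObj X

  _∘P_ : ∀ {X Y W} → PHom Y W → PHom X Y → PHom X W
  _∘P_ {X} {Y} {W} g k = record
    { f = f g ∘ f k
    ; α = λ Θ γ x → subst (W.Γ† Θ) (P.sym (S.assoc (f g) (f k) γ))
                       (α g Θ (f k ∘ γ) (α k Θ γ x))
    ; nat = λ {Θ} {Θ'} u {γ} x →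
        H.trans (sr (W.Γ† Θ') _ _)
        (H.trans (αcong g (P.sym (S.assoc (f k) γ (F.F₁ u))) (nat k u x))
        (H.trans (nat g u (α k Θ γ x))
                 (restcong W u (P.sym (S.assoc (f g) (f k) γ))
                   (H.sym (sr (W.Γ† Θ) _ _)))))
    }
    where module W = PObj W

  𝒫 : Category (suc 0ℓ ⊔ o ⊔ h) (o ⊔ h) h
  𝒫 = record
    { Obj = PObj
    ; Hom = PHom
    ; _≈_ = _≈P_
    ; isEquiv = record
        { refl = refl , (λ _ _ _ → H.refl)
        ; sym = λ { (e , a) → P.sym e , (λ Θ γ x → H.sym (a Θ γ x)) }
        ; trans = λ { (e , a) (e' , a') →
                        P.trans e e' , (λ Θ γ x → H.trans (a Θ γ x) (a' Θ γ x)) } }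
    ; id = idP
    ; _∘_ = _∘P_
    ; assoc = λ {_} {_} {Cc} {D} m g k → S.assoc (f m) (f g) (f k) ,
        (λ Θ γ x →
          H.trans (sr (PObj.Γ† D Θ) (P.sym (S.assoc (f m ∘ f g) (f k) γ))
                      (α (m ∘P g) Θ (f k ∘ γ) (α k Θ γ x)))
          (H.trans (sr (PObj.Γ† D Θ) (P.sym (S.assoc (f m) (f g) (f k ∘ γ)))
                       (α m Θ (f g ∘ (f k ∘ γ)) (α g Θ (f k ∘ γ) (α k Θ γ x))))
          (H.trans (αcong m (P.sym (S.assoc (f g) (f k) γ))
                     (H.sym (sr (PObj.Γ† Cc Θ) (P.sym (S.assoc (f g) (f k) γ))
                                (α g Θ (f k ∘ γ) (α k Θ γ x)))))
                   (H.sym (sr (PObj.Γ† D Θ) (P.sym (S.assoc (f m) (f g ∘ f k) γ))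
                              (α m Θ ((f g ∘ f k) ∘ γ) (α (g ∘P k) Θ γ x)))))))
    ; identityˡ = λ {_} {B} m → S.identityˡ (f m) ,
        (λ Θ γ x → H.trans (sr (PObj.Γ† B Θ) (P.sym (S.assoc S.id (f m) γ))
                                  (α (idP {B}) Θ (f m ∘ γ) (α m Θ γ x)))
                              (sr (PObj.Γ† B Θ) (P.sym (S.identityˡ (f m ∘ γ)))
                                  (α m Θ γ x)))
    ; identityʳ = λ {A} {B} m → S.identityʳ (f m) ,
        (λ Θ γ x → H.trans (sr (PObj.Γ† B Θ) _ _)
                     (αcong m (S.identityˡ γ) (sr (PObj.Γ† A Θ) _ _)))
    ; ∘-resp-≈ = λ {_} {_} {W} {g} {g'} {k} {k'} (e1 , h1) (e2 , h2) →
        cong₂ _∘_ e1 e2 ,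
        (λ Θ γ x → H.trans (sr (PObj.Γ† W Θ) _ _)
                   (H.trans (αcong2 g g' h1 (cong (_∘ γ) e2) (h2 Θ γ x))
                            (H.sym (sr (PObj.Γ† W Θ) _ _))))
    }

  G : Functor 𝒫 (toCat S)
  G = record
    { F₀ = PObj.Γ
    ; F₁ = f
    ; F-resp-≈ = proj₁
    ; identity = refl
    ; homomorphism = λ _ _ → refl
    }

module Submission where

-- The projection G : 𝒫 → 𝒮 is a fibration: a morphism ρ : r → Γ into the base
-- of (Γ , Γ†) lifts to a cartesian morphism (r , Γ†(- , ρ ∘ -)) → (Γ , Γ†).
-- Given z ∈ Z(Γ), let (r , ρ) represent the fibre of B at (Γ , z).  Since G is
-- the identity on the fibres of G* B, and maps in 𝒫 / (Γ , Γ†) into the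
-- cartesian lift of ρ correspond to maps in 𝒮 / Γ into (r , ρ), the cartesian
-- lift of ρ represents the fibre of G* B at ((Γ , Γ†) , z).

open import Level using (Level; 0ℓ)
open import Defs
open import Axiom.UniquenessOfIdentityProofs.WithK using (uip)
open import Data.Product using (_,_; proj₁; proj₂)
open import Relation.Binary.PropositionalEquality as P
  using (_≡_; refl; subst; cong)
open import Relation.Binary.HeterogeneousEquality as H using (_≅_)

module _ {o h e o' h' e'} {E' : Category o' h' e'} {E : Category o h e}
         (G : Functor E' E) where
  private
    module E' = Category E'
    module E = Category E
    module G = Functor G

  sliceHom : ∀ {c d d'} {σ : E'.Hom d c} {σ' : E'.Hom d' c} →
             Category.Hom (Slice E' c) (d , σ) (d' , σ') →
             Category.Hom (Slice E (G.F₀ c)) (G.F₀ d , G.F₁ σ) (G.F₀ d' , G.F₁ σ')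
  sliceHom {σ' = σ'} (k , pk) =
    G.F₁ k , E.≈-trans (E.≈-sym (G.homomorphism σ' k)) (G.F-resp-≈ pk)

  -- Both sides transport the same element along proofs of the same equation in Z.
  fiber-reindexDep-F₁ : ∀ {p q} {Z : Presheaf E p} (B : DepPresheaf Z q) c z
    {d d'} {σ : E'.Hom d c} {σ' : E'.Hom d' c}
    (k : Category.Hom (Slice E' c) (d , σ) (d' , σ'))
    (x : Presheaf.F₀ (Fiber (reindexDep G B) c z) (d' , σ')) →
    Presheaf.F₁ (Fiber (reindexDep G B) c z) k x
      ≡ Presheaf.F₁ (Fiber B (G.F₀ c) z) (sliceHom k) x
  fiber-reindexDep-F₁ B c z {d} (k , _) x =
    cong (λ eq → subst (DepPresheaf.D₀ B (G.F₀ d)) eq (DepPresheaf.D₁ B (G.F₁ k) x))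
         (uip _ _)

module Fibration {o h} (C : StrictCategory 0ℓ 0ℓ) (S : StrictCategory o h)
                 (F : StrictFunctor C S) where
  open Displayed C S F
  open PHom
  private
    module C = StrictCategory C
    module S = StrictCategory S
    module F = StrictFunctor F
    sr = H.≡-subst-removable

  module _ (X : PObj) {r : S.Obj} (ρ : S.Hom r (PObj.Γ X)) where
    private
      module X = PObj X

      rest-cong : ∀ {Θ Θ'} (u : C.Hom Θ' Θ) {γ₁ γ₂} → γ₁ ≡ γ₂ →
                  {x₁ : X.Γ† Θ γ₁} {x₂ : X.Γ† Θ γ₂} → x₁ ≅ x₂ →
                  X.rest u x₁ ≅ X.rest u x₂
      rest-cong u refl H.refl = H.refl

    restrict : PObj
    restrict = record
      { Γ = r
      ; Γ† = λ Θ γ → X.Γ† Θ (ρ S.∘ γ)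
      ; rest = λ {Θ} {Θ'} u {γ} x →
          subst (X.Γ† Θ') (S.assoc ρ γ (F.F₁ u)) (X.rest u x)
      ; rest-id = λ {Θ} x → H.trans (sr (X.Γ† Θ) _ _) (X.rest-id x)
      ; rest-∘ = λ {Θ} {Θ'} {Θ''} u v {γ} x →
          H.trans (sr (X.Γ† Θ'') _ _)
          (H.trans (X.rest-∘ u v x)
          (H.trans (rest-cong v (S.assoc ρ γ (F.F₁ u)) (H.sym (sr (X.Γ† Θ') _ _)))
                   (H.sym (sr (X.Γ† Θ'') _ _))))
      }

    cartesianLift : PHom restrict X
    cartesianLift = record
      { f = ρ
      ; α = λ Θ γ x → x
      ; nat = λ {Θ} {Θ'} u x → sr (X.Γ† Θ') _ _
      }

    module _ {D : PObj} (σ : PHom D X) (g : S.Hom (PObj.Γ D) r)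
             (ρg≡σ : ρ S.∘ g ≡ f σ) where
      private
        factor-type : ∀ {Θ} (δ : S.Hom (F.F₀ Θ) (PObj.Γ D)) →
                      f σ S.∘ δ ≡ ρ S.∘ (g S.∘ δ)
        factor-type δ = P.trans (cong (S._∘ δ) (P.sym ρg≡σ)) (S.assoc ρ g δ)

      factor : PHom D restrict
      factor = record
        { f = g
        ; α = λ Θ δ y → subst (X.Γ† Θ) (factor-type δ) (α σ Θ δ y)
        ; nat = λ {Θ} {Θ'} u {δ} y →
            H.trans (sr (X.Γ† Θ') _ _)
            (H.trans (nat σ u y)
            (H.trans (rest-cong u (factor-type δ) (H.sym (sr (X.Γ† Θ) _ _)))
                     (H.sym (sr (X.Γ† Θ') _ _))))
        }

      cartesianLift-factor : (cartesianLift ∘P factor) ≈P σ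
      cartesianLift-factor = ρg≡σ , λ Θ δ y →
        H.trans (sr (X.Γ† Θ) (P.sym (S.assoc ρ g δ)) _)
                (sr (X.Γ† Θ) (factor-type δ) (α σ Θ δ y))

      factor-unique : (m : PHom D restrict) → (cartesianLift ∘P m) ≈P σ →
                      g ≡ f m → factor ≈P m
      factor-unique m (_ , lift-m≈σ) g≡m = g≡m , λ Θ δ y →
        H.trans (sr (X.Γ† Θ) (factor-type δ) (α σ Θ δ y))
          (H.trans (H.sym (lift-m≈σ Θ δ y))
                   (sr (X.Γ† Θ) (P.sym (S.assoc ρ (f m) δ)) (α m Θ δ y)))

  module _ {p q} {Z : Presheaf (toCat S) p} (B : DepPresheaf Z q) where

    representable-reindexDep-fiber : ∀ c z → Representable (Fiber B (PObj.Γ c) z) →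
                                     Representable (Fiber (reindexDep G B) c z)
    representable-reindexDep-fiber c z Rep = record
      { r = lifted
      ; φ = λ { {_ , σ} m → φ σ m }
      ; ψ = λ { {_ , σ} x → ψ σ x }
      ; φ-resp = λ { {_ , σ} m≈m' → Rep.φ-resp (proj₁ m≈m') }
      ; φψ = λ { {d , σ} x → Rep.φψ {PObj.Γ d , f σ} x }
      ; ψφ = λ { {_ , σ} m → ψφ σ m }
      ; natural = λ { {_ , σ} {_ , τ} m k → natural σ τ m k }
      }
      where
      module Rep = Representable Rep
      module Fib = Presheaf (Fiber B (PObj.Γ c) z)
      module Fib* = Presheaf (Fiber (reindexDep G B) c z)
      open Category using (Hom; _∘_)
      open P.≡-Reasoning

      ρ = proj₂ Rep.r

      π : PHom (restrict c ρ) c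
      π = cartesianLift c ρ

      lifted : Category.Obj (Slice 𝒫 c)
      lifted = restrict c ρ , π

      G/c : ∀ {d d'} (σ : PHom d c) (σ' : PHom d' c) →
            Hom (Slice 𝒫 c) (d , σ) (d' , σ') →
            Hom (Slice (toCat S) (PObj.Γ c)) (PObj.Γ d , f σ) (PObj.Γ d' , f σ')
      G/c σ σ' = sliceHom G {σ = σ} {σ'}

      φ : ∀ {d} (σ : PHom d c) → Hom (Slice 𝒫 c) (d , σ) lifted → Fib*.F₀ (d , σ)
      φ {d} σ m = Rep.φ {PObj.Γ d , f σ} (G/c σ π m)

      ψ : ∀ {d} (σ : PHom d c) → Fib*.F₀ (d , σ) → Hom (Slice 𝒫 c) (d , σ) lifted
      ψ σ x = let (g , ρg≡σ) = Rep.ψ x in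
              factor c ρ σ g ρg≡σ , cartesianLift-factor c ρ σ g ρg≡σ

      ψφ : ∀ {d} (σ : PHom d c) (m : Hom (Slice 𝒫 c) (d , σ) lifted) →
           Category._≈_ (Slice 𝒫 c) {d , σ} {lifted} (ψ σ (φ σ m)) m
      ψφ {d} σ (m , lift-m≈σ) =
        let (g , ρg≡σ) = Rep.ψ (φ σ (m , lift-m≈σ)) in
        factor-unique c ρ σ g ρg≡σ m lift-m≈σ
          (Rep.ψφ {PObj.Γ d , f σ} (G/c σ π (m , lift-m≈σ)))

      natural : ∀ {d d'} (σ : PHom d c) (τ : PHom d' c)
                (m : Hom (Slice 𝒫 c) (d' , τ) lifted)
                (k : Hom (Slice 𝒫 c) (d , σ) (d' , τ)) →
                φ σ (_∘_ (Slice 𝒫 c) {d , σ} {d' , τ} {lifted} m k)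
                  ≡ Fib*.F₁ {d , σ} {d' , τ} k (φ τ m)
      natural {d} {d'} σ τ m k = begin
        φ σ (_∘_ (Slice 𝒫 c) {d , σ} {d' , τ} {lifted} m k)
          ≡⟨ Rep.φ-resp {PObj.Γ d , f σ} refl ⟩
        Rep.φ (_∘_ (Slice (toCat S) (PObj.Γ c)) {PObj.Γ d , f σ} {PObj.Γ d' , f τ} {Rep.r}
                   (G/c τ π m) (G/c σ τ k))
          ≡⟨ Rep.natural {PObj.Γ d , f σ} {PObj.Γ d' , f τ} (G/c τ π m) (G/c σ τ k) ⟩
        Fib.F₁ {PObj.Γ d , f σ} {PObj.Γ d' , f τ} (G/c σ τ k) (φ τ m)
          ≡⟨ P.sym (fiber-reindexDep-F₁ G B c z {σ = σ} {τ} k (φ τ m)) ⟩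
        Fib*.F₁ {d , σ} {d' , τ} k (φ τ m) ∎

proposition28 : ∀ {o h p q : Level} (C : StrictCategory 0ℓ 0ℓ)
    (S : StrictCategory o h) (F : StrictFunctor C S)
    (Z : Presheaf (toCat S) p) (B : DepPresheaf Z q) →
    LocallyRepresentable B →
    LocallyRepresentable (reindexDep (Displayed.G C S F) B)
proposition28 C S F Z B locRep c z =
  Fibration.representable-reindexDep-fiber C S F B c z (locRep (PObj.Γ c) z)
  where open Displayed C S F
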